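{- The number of Cayley permutations of length $0$ avoiding $112$ and the number avoiding $212$ are both $1$, and for every $n\ge1$ the number of Cayley permutations of length $n$ avoiding $112$ and the number avoiding $212$ are both equal to $\frac{(n+1)!}{2}$.
   Context: A Cayley permutation of length $n$ is a word $w=w_1\cdots w_n$ of positive integers with $\{w_1,\dots,w_n\}=[k]$ for some $k\le n$. It avoids $112$ if there are no $i<j<k$ with $w_i=w_j<w_k$, and avoids $212$ if there are no $i<j<k$ with $w_i=w_k>w_j$. -}

module Defs where

open import Data.Nat using (ℕ; zero; suc; _≤_; _<_; _≤?_; _<?_; _≟_)
open import Data.Fin using (Fin; toℕ)
import Data.Fin as F
import Data.Fin.Properties as FP
open import Data.Vec using (Vec; lookup; []; _∷_)
open import Data.List using (List; []; _∷_; filter; length; map; concatMap; upTo)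
open import Data.Product using (Σ; ∃; _×_; _,_; ∃-syntax)
open import Relation.Binary.PropositionalEquality using (_≡_)
open import Relation.Nullary using (¬_; Dec)
open import Relation.Nullary.Decidable using (_×-dec_; ¬?)

-- Cayley permutation: the set of letters is exactly [k] = {1,…,k} for some k ≤ n.
-- (k ranges over Fin (suc n), i.e. k ∈ {0,…,n}; a letter v ∈ [k] is written suc (toℕ v) with v : Fin k.)
IsCayley : ∀ {n} → Vec ℕ n → Set
IsCayley {n} w =
  ∃[ k ] ( (∀ i → 1 ≤ lookup w i × lookup w i ≤ toℕ {suc n} k)
         × (∀ (v : Fin (toℕ k)) → ∃[ i ] lookup w i ≡ suc (toℕ v)))

Contains112 : ∀ {n} → Vec ℕ n → Set
Contains112 {n} w = ∃[ i ] ∃[ j ] ∃[ k ]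
  (i F.< j × j F.< k × lookup w i ≡ lookup w j × lookup w j < lookup w k)

Contains212 : ∀ {n} → Vec ℕ n → Set
Contains212 {n} w = ∃[ i ] ∃[ j ] ∃[ k ]
  (i F.< j × j F.< k × lookup w i ≡ lookup w k × lookup w j < lookup w k)

Avoids112 : ∀ {n} → Vec ℕ n → Set
Avoids112 w = ¬ Contains112 w

Avoids212 : ∀ {n} → Vec ℕ n → Set
Avoids212 w = ¬ Contains212 w

isCayley? : ∀ {n} (w : Vec ℕ n) → Dec (IsCayley w)
isCayley? {n} w = FP.any? λ k →
  FP.all? (λ i → (1 ≤? lookup w i) ×-dec (lookup w i ≤? toℕ k))
  ×-dec FP.all? (λ v → FP.any? (λ i → lookup w i ≟ suc (toℕ v)))

contains112? : ∀ {n} (w : Vec ℕ n) → Dec (Contains112 w)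
contains112? w = FP.any? λ i → FP.any? λ j → FP.any? λ k →
  (i FP.<? j) ×-dec (j FP.<? k) ×-dec (lookup w i ≟ lookup w j) ×-dec (lookup w j <? lookup w k)

contains212? : ∀ {n} (w : Vec ℕ n) → Dec (Contains212 w)
contains212? w = FP.any? λ i → FP.any? λ j → FP.any? λ k →
  (i FP.<? j) ×-dec (j FP.<? k) ×-dec (lookup w i ≟ lookup w k) ×-dec (lookup w j <? lookup w k)

-- Every Cayley permutation of
-- length n has all letters in {1,…,n} (since k ≤ n), so words n n contains
-- every Cayley permutation of length n, each exactly once.
words : (m n : ℕ) → List (Vec ℕ m)
words zero    n = [] ∷ []
words (suc m) n = concatMap (λ a → map (suc a ∷_) (words m n)) (upTo n)

count112 : ℕ → ℕ
count112 n = length (filter (λ w → isCayley? w ×-dec ¬? (contains112? w)) (words n n))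

count212 : ℕ → ℕ
count212 n = length (filter (λ w → isCayley? w ×-dec ¬? (contains212? w)) (words n n))

-- Every Cayley permutation of length n + 2 avoiding 112 (or 212) arises from exactly one
-- avoider of length n + 1 by exactly one of n + 3 insertions, so the counts satisfy
-- c(n + 2) = (n + 3) c(n + 1) with c(1) = 1, i.e. c(n) = (n + 1)! / 2.
--
-- For 112 the insertions are: append a 1, or raise every letter by one and put a new 1 at
-- any of the n + 2 positions.  They are undone by looking at the first 1: if another 1
-- follows it, avoidance of 112 forces the last letter to be 1, which is removed; otherwise
-- the 1 is removed and every other letter lowered.
--
-- For 212 the insertions are: duplicate the maximum M just before its first occurrence, or
-- put a new maximum M + 1 at any position.  Both are undone by removing the first occurrence
-- of the maximum, because in a 212-avoider all occurrences of the maximum are adjacent.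

module Submission where

open import Defs
open import Data.Bool using (if_then_else_)
open import Data.Empty using (⊥-elim)
open import Data.Fin as F using (Fin; toℕ; fromℕ; fromℕ<; punchIn)
import Data.Fin.Properties as FP
open import Data.List as L using (List; length; filter; upTo; allFin; cartesianProduct; cartesianProductWith; concatMap)
import Data.List.Properties as LP
open import Data.List.Membership.Propositional using (_∈_)
open import Data.List.Membership.Propositional.Properties
open import Data.List.Membership.Propositional.Properties.WithK using (unique∧set⇒bag)
open import Data.List.Relation.Binary.BagAndSetEquality using (∼bag⇒↭)
open import Data.List.Relation.Binary.Permutation.Propositional.Properties using (↭-length)
open import Data.List.Relation.Unary.All as All using (All)
open import Data.List.Relation.Unary.AllPairs as AllPairs using ()
open import Data.List.Relation.Unary.Any using (here)
open import Data.List.Relation.Unary.Unique.Propositional using (Unique)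
import Data.List.Relation.Unary.Unique.Propositional.Properties as Unique
open import Data.Nat using (ℕ; zero; suc; pred; >-nonZero; _+_; _*_; _⊔_; _!; _≤_; _<_; _≟_; z≤n; s≤s)
open import Data.Nat.Properties
open import Data.Nat.DivMod using (_/_; m*n/n≡m)
open import Data.Sum using (inj₁; inj₂)
open import Data.Product using (∃-syntax; _×_; _,_; proj₁; proj₂)
open import Data.Vec as V using (Vec; []; _∷_; lookup; insertAt; removeAt)
import Data.Vec.Properties as VP
open import Function using (_∘_; id)
open import Function.Bundles using (mk⇔)
open import Relation.Binary.PropositionalEquality
open import Relation.Nullary using (¬_; Dec; yes; no; does)
open import Relation.Nullary.Decidable using (_×-dec_; ¬?; dec-true; dec-false)

if-does-yes : ∀ {A P : Set} (P? : Dec P) {x y : A} → P → (if does P? then x else y) ≡ x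
if-does-yes P? p rewrite dec-true P? p = refl

if-does-no : ∀ {A P : Set} (P? : Dec P) {x y : A} → ¬ P → (if does P? then x else y) ≡ y
if-does-no P? ¬p rewrite dec-false P? ¬p = refl

length-cartesianProductWith : ∀ {A B C : Set} (f : A → B → C) (xs : List A) (ys : List B) →
  length (cartesianProductWith f xs ys) ≡ length xs * length ys
length-cartesianProductWith f L.[] ys = refl
length-cartesianProductWith f (x L.∷ xs) ys = begin
  length (L.map (f x) ys L.++ cartesianProductWith f xs ys)
    ≡⟨ LP.length-++ (L.map (f x) ys) ⟩
  length (L.map (f x) ys) + length (cartesianProductWith f xs ys)
    ≡⟨ cong₂ _+_ (LP.length-map (f x) ys) (length-cartesianProductWith f xs ys) ⟩
  length ys + length xs * length ys ∎
  where open ≡-Reasoning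

concatMap-map≡cartesianProductWith : ∀ {A B C : Set} (f : A → B → C) (xs : List A) (ys : List B) →
  concatMap (λ x → L.map (f x) ys) xs ≡ cartesianProductWith f xs ys
concatMap-map≡cartesianProductWith f L.[] ys = refl
concatMap-map≡cartesianProductWith f (x L.∷ xs) ys =
  cong (L.map (f x) ys L.++_) (concatMap-map≡cartesianProductWith f xs ys)

unique-length : ∀ {A : Set} {xs ys : List A} → Unique xs → Unique ys →
  (∀ {z} → z ∈ xs → z ∈ ys) → (∀ {z} → z ∈ ys → z ∈ xs) → length xs ≡ length ys
unique-length xs! ys! to from = ↭-length (∼bag⇒↭ (unique∧set⇒bag xs! ys! (mk⇔ to from)))

map-unique : ∀ {A B : Set} {f : A → B} (g : B → A) {xs : List A} →
  All (λ x → g (f x) ≡ x) xs → Unique xs → Unique (L.map f xs)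
map-unique {f = f} g {xs} gf≡id xs! = Unique.map⁻ (subst Unique (sym g∘f≡id) xs!)
  where
  g∘f≡id : L.map g (L.map f xs) ≡ xs
  g∘f≡id = trans (sym (LP.map-∘ xs)) (LP.map-id-local gf≡id)

words-suc : ∀ m N → words (suc m) N ≡ cartesianProductWith (λ a w → suc a ∷ w) (upTo N) (words m N)
words-suc m N = concatMap-map≡cartesianProductWith _ (upTo N) (words m N)

words-unique : ∀ m N → Unique (words m N)
words-unique zero N = All.[] AllPairs.∷ AllPairs.[]
words-unique (suc m) N rewrite words-suc m N =
  Unique.cartesianProductWith⁺ _ ∷-injective (Unique.upTo⁺ N) (words-unique m N)
  where
  ∷-injective : ∀ {a b} {w z : Vec ℕ m} → _≡_ {A = Vec ℕ (suc m)} (suc a ∷ w) (suc b ∷ z) → a ≡ b × w ≡ z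
  ∷-injective refl = refl , refl

∈-words : ∀ m N (w : Vec ℕ m) → (∀ i → 1 ≤ lookup w i) → (∀ i → lookup w i ≤ N) → w ∈ words m N
∈-words zero N [] _ _ = here refl
∈-words (suc m) N (suc a ∷ w) pos bnd rewrite words-suc m N =
  ∈-cartesianProductWith⁺ _ (∈-upTo⁺ (bnd F.zero)) (∈-words m N w (pos ∘ F.suc) (bnd ∘ F.suc))
∈-words (suc m) N (zero ∷ w) pos bnd with pos F.zero
... | ()

subst₃ : ∀ {A : Set} (P : A → A → A → Set) {a a′ b b′ c c′} →
  a ≡ a′ → b ≡ b′ → c ≡ c′ → P a b c → P a′ b′ c′
subst₃ P refl refl refl p = p

lookup-removeAt : ∀ {A : Set} {m} (w : Vec A (suc m)) q j → lookup (removeAt w q) j ≡ lookup w (punchIn q j)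
lookup-removeAt w q j = begin
  lookup (removeAt w q) j                                  ≡⟨ VP.insertAt-punchIn (removeAt w q) q (lookup w q) j ⟨
  lookup (insertAt (removeAt w q) q (lookup w q)) (punchIn q j) ≡⟨ cong (λ v → lookup v (punchIn q j)) (VP.insertAt-removeAt w q) ⟩
  lookup w (punchIn q j) ∎
  where open ≡-Reasoning

punchIn-view : ∀ {m} (q i : Fin (suc m)) → i ≢ q → ∃[ i′ ] punchIn q i′ ≡ i
punchIn-view q i i≢q = F.punchOut (i≢q ∘ sym) , FP.punchIn-punchOut (i≢q ∘ sym)

punchIn-mono-< : ∀ {m} (q : Fin (suc m)) {i j : Fin m} → i F.< j → punchIn q i F.< punchIn q j
punchIn-mono-< q {i} {j} i<j = FP.≤∧≢⇒< (FP.punchIn-mono-≤ q i j (<⇒≤ i<j))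
  (λ eq → <-irrefl (cong toℕ (FP.punchIn-injective q i j eq)) i<j)

punchIn-cancel-< : ∀ {m} (q : Fin (suc m)) {i j : Fin m} → punchIn q i F.< punchIn q j → i F.< j
punchIn-cancel-< q {i} {j} lt = FP.≤∧≢⇒< (FP.punchIn-cancel-≤ q i j (<⇒≤ lt))
  (λ i≡j → <-irrefl (cong (toℕ ∘ punchIn q) i≡j) lt)

punchIn-inject₁-self : ∀ {m} (q : Fin m) → punchIn (F.inject₁ q) q ≡ F.suc q
punchIn-inject₁-self F.zero    = refl
punchIn-inject₁-self (F.suc q) = cong F.suc (punchIn-inject₁-self q)

inject₁≤punchIn : ∀ {m} {q i : Fin m} → q F.≤ i → F.inject₁ q F.≤ punchIn (F.inject₁ q) i
inject₁≤punchIn {q = F.zero}                  _         = z≤n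
inject₁≤punchIn {q = F.suc q} {i = F.suc i} (s≤s q≤i) = s≤s (inject₁≤punchIn q≤i)

inject₁<⇒suc≤ : ∀ {m} {i : Fin m} {j : Fin (suc m)} → F.inject₁ i F.< j → F.suc i F.≤ j
inject₁<⇒suc≤ {i = i} {j} lt = subst (λ x → suc x ≤ toℕ j) (FP.toℕ-inject₁ i) lt

inject₁<punchIn⇒≤ : ∀ {m} {q i : Fin m} → F.inject₁ q F.< punchIn (F.inject₁ q) i → q F.≤ i
inject₁<punchIn⇒≤ {q = F.zero}                  _         = z≤n
inject₁<punchIn⇒≤ {q = F.suc q} {i = F.suc i} (s≤s q<i) = s≤s (inject₁<punchIn⇒≤ q<i)

Occurs : ∀ {m} → ℕ → Vec ℕ m → Set
Occurs v w = ∃[ i ] lookup w i ≡ v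

occurs? : ∀ {m} v (w : Vec ℕ m) → Dec (Occurs v w)
occurs? v w = FP.any? (λ i → lookup w i ≟ v)

Occurs-removeAt : ∀ {m} (w : Vec ℕ (suc m)) q {i} → i ≢ q → ∀ {v} → lookup w i ≡ v → Occurs v (removeAt w q)
Occurs-removeAt w q {i} i≢q wi≡v with punchIn-view q i i≢q
... | i′ , refl = i′ , trans (lookup-removeAt w q i′) wi≡v

∀-insertAt : ∀ {A : Set} {m} (P : A → Set) (u : Vec A m) q {x} →
  P x → (∀ j → P (lookup u j)) → ∀ i → P (lookup (insertAt u q x) i)
∀-insertAt P u q {x} px pu i with i FP.≟ q
... | yes refl = subst P (sym (VP.insertAt-lookup u i x)) px
... | no i≢q with punchIn-view q i i≢q
...   | j , refl = subst P (sym (VP.insertAt-punchIn u q x j)) (pu j)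

∀-removeAt : ∀ {A : Set} {m} (P : A → Set) (w : Vec A (suc m)) q →
  (∀ i → P (lookup w i)) → ∀ j → P (lookup (removeAt w q) j)
∀-removeAt P w q pw j = subst P (sym (lookup-removeAt w q j)) (pw (punchIn q j))

Occurs-insertAt : ∀ {m} {v} (u : Vec ℕ m) q x → Occurs v u → Occurs v (insertAt u q x)
Occurs-insertAt u q x (j , uj≡v) = punchIn q j , trans (VP.insertAt-punchIn u q x j) uj≡v

Occurs-map : ∀ {m} {v} (f : ℕ → ℕ) (u : Vec ℕ m) → Occurs v u → Occurs (f v) (V.map f u)
Occurs-map f u (j , uj≡v) = j , trans (VP.lookup-map j f u) (cong f uj≡v)

record Cayley {m} (K : ℕ) (w : Vec ℕ m) : Set where
  constructor cayley
  field
    positive : ∀ i → 1 ≤ lookup w i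
    bounded  : ∀ i → lookup w i ≤ K
    onto     : ∀ v → v < K → Occurs (suc v) w

module _ {m} {K} {w : Vec ℕ m} (c : Cayley K w) where
  open Cayley c

  Cayley-≤-length : K ≤ m
  Cayley-≤-length = FP.injective⇒≤ position-injective
    where
    position : Fin K → Fin m
    position v = proj₁ (onto (toℕ v) (FP.toℕ<n v))
    position-injective : ∀ {a b} → position a ≡ position b → a ≡ b
    position-injective {a} {b} eq = FP.toℕ-injective (suc-injective (begin
      suc (toℕ a)           ≡⟨ proj₂ (onto (toℕ a) (FP.toℕ<n a)) ⟨
      lookup w (position a) ≡⟨ cong (lookup w) eq ⟩
      lookup w (position b) ≡⟨ proj₂ (onto (toℕ b) (FP.toℕ<n b)) ⟩
      suc (toℕ b)           ∎))
      where open ≡-Reasoning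

  Cayley⇒IsCayley : IsCayley w
  Cayley⇒IsCayley = k , (λ i → positive i , subst (lookup w i ≤_) (sym k≡K) (bounded i))
                      , (λ v → onto (toℕ v) (subst (toℕ v <_) k≡K (FP.toℕ<n v)))
    where
    k : Fin (suc m)
    k = fromℕ< (s≤s Cayley-≤-length)
    k≡K : toℕ k ≡ K
    k≡K = FP.toℕ-fromℕ< (s≤s Cayley-≤-length)

Cayley-insertAt : ∀ {m} {K} {u : Vec ℕ m} → Cayley K u → ∀ q {x} → 1 ≤ x → x ≤ K → Cayley K (insertAt u q x)
Cayley-insertAt {K = K} {u} (cayley positive bounded onto) q {x} 1≤x x≤K =
  cayley (∀-insertAt (1 ≤_) u q 1≤x positive) (∀-insertAt (_≤ K) u q x≤K bounded)
         (λ v v<K → Occurs-insertAt u q x (onto v v<K))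

IsCayley⇒Cayley : ∀ {m} {w : Vec ℕ m} → IsCayley w → ∃[ K ] Cayley K w
IsCayley⇒Cayley {w = w} (k , bounds , onto) = toℕ k , cayley (proj₁ ∘ bounds) (proj₂ ∘ bounds) onto′
  where
  onto′ : ∀ v → v < toℕ k → Occurs (suc v) w
  onto′ v v<k with onto (fromℕ< v<k)
  ... | i , wi≡ = i , trans wi≡ (cong suc (FP.toℕ-fromℕ< v<k))

Cayley-nonempty : ∀ {m} {K} {w : Vec ℕ (suc m)} → Cayley K w → 1 ≤ K
Cayley-nonempty (cayley positive bounded _) = ≤-trans (positive F.zero) (bounded F.zero)

maximum : ∀ {m} → Vec ℕ m → ℕ
maximum []       = 0
maximum (x ∷ xs) = x ⊔ maximum xs

lookup≤maximum : ∀ {m} (w : Vec ℕ m) i → lookup w i ≤ maximum w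
lookup≤maximum (x ∷ xs) F.zero    = m≤m⊔n x (maximum xs)
lookup≤maximum (x ∷ xs) (F.suc i) = ≤-trans (lookup≤maximum xs i) (m≤n⊔m x (maximum xs))

maximum-least : ∀ {m} (w : Vec ℕ m) {K} → (∀ i → lookup w i ≤ K) → maximum w ≤ K
maximum-least []       w≤K = z≤n
maximum-least (x ∷ xs) w≤K = ⊔-lub (w≤K F.zero) (maximum-least xs (w≤K ∘ F.suc))

maximum-attained : ∀ {m} (w : Vec ℕ m) {K} → (∀ i → lookup w i ≤ K) → Occurs K w → maximum w ≡ K
maximum-attained w w≤K (i , wi≡K) = ≤-antisym (maximum-least w w≤K) (subst (_≤ maximum w) wi≡K (lookup≤maximum w i))

Cayley-top : ∀ {m} {K} {w : Vec ℕ (suc m)} → Cayley K w → Occurs K w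
Cayley-top {K = suc K} (cayley _ _ onto) = onto K ≤-refl
Cayley-top {K = zero}  c with Cayley-nonempty c
... | ()

Cayley-maximum : ∀ {m} {K} {w : Vec ℕ (suc m)} → Cayley K w → maximum w ≡ K
Cayley-maximum {w = w} c = maximum-attained w (Cayley.bounded c) (Cayley-top c)

Cayley-at-maximum : ∀ {m} {K} {w : Vec ℕ (suc m)} → Cayley K w → Cayley (maximum w) w
Cayley-at-maximum {w = w} c = subst (λ K → Cayley K w) (sym (Cayley-maximum c)) c

first : ∀ {m} → ℕ → Vec ℕ (suc m) → Fin (suc m)
first {zero}  v (x ∷ [])     = F.zero
first {suc m} v (x ∷ xs) with x ≟ v
... | yes _ = F.zero
... | no _  = F.suc (first v xs)

lookup-first : ∀ {m} {v} (w : Vec ℕ (suc m)) → Occurs v w → lookup w (first v w) ≡ v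
lookup-first {zero}      (x ∷ []) (F.zero , x≡v) = x≡v
lookup-first {suc m} {v} (x ∷ xs) occ with x ≟ v | occ
... | yes x≡v | _              = x≡v
... | no x≢v  | F.zero , x≡v   = ⊥-elim (x≢v x≡v)
... | no _    | F.suc i , xi≡v = lookup-first xs (i , xi≡v)

first-≤ : ∀ {m} {v} (w : Vec ℕ (suc m)) {i} → lookup w i ≡ v → first v w F.≤ i
first-≤ {zero}      (x ∷ [])             _    = z≤n
first-≤ {suc m} {v} (x ∷ xs) {i} wi≡v with x ≟ v | i
... | yes _   | _       = z≤n
... | no x≢v  | F.zero  = ⊥-elim (x≢v wi≡v)
... | no _    | F.suc i = s≤s (first-≤ xs wi≡v)

first-unique : ∀ {m} {v} (w : Vec ℕ (suc m)) {p} → lookup w p ≡ v →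
  (∀ {i} → lookup w i ≡ v → p F.≤ i) → first v w ≡ p
first-unique w wp≡v p-least = FP.≤-antisym (first-≤ w wp≡v) (p-least (lookup-first w (_ , wp≡v)))

Pattern : (ℕ → ℕ → ℕ → Set) → ∀ {m} → Vec ℕ m → Set
Pattern R w = ∃[ i ] ∃[ j ] ∃[ k ] (i F.< j × j F.< k × R (lookup w i) (lookup w j) (lookup w k))

Avoider : (ℕ → ℕ → ℕ → Set) → ∀ {m} → Vec ℕ m → Set
Avoider R w = IsCayley w × ¬ Pattern R w

module _ {R : ℕ → ℕ → ℕ → Set} where

  ¬Pattern-singleton : ∀ {x} → ¬ Pattern R (x ∷ [])
  ¬Pattern-singleton (F.zero , F.zero , _ , () , _)

  Avoider-singleton : Avoider R (1 ∷ [])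
  Avoider-singleton = Cayley⇒IsCayley {w = 1 ∷ []} (cayley (λ { F.zero → ≤-refl }) (λ { F.zero → ≤-refl })
                                              (λ { zero _ → F.zero , refl ; (suc _) (s≤s ()) })) ,
                      ¬Pattern-singleton

  Pattern-removeAt⁻ : ∀ {m} (w : Vec ℕ (suc m)) q → Pattern R (removeAt w q) → Pattern R w
  Pattern-removeAt⁻ w q (i , j , k , i<j , j<k , r) =
    punchIn q i , punchIn q j , punchIn q k , punchIn-mono-< q i<j , punchIn-mono-< q j<k ,
    subst₃ R (lookup-removeAt w q i) (lookup-removeAt w q j) (lookup-removeAt w q k) r

  Pattern-removeAt⁺ : ∀ {m} (w : Vec ℕ (suc m)) q {i j k} → i ≢ q → j ≢ q → k ≢ q → i F.< j → j F.< k →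
    R (lookup w i) (lookup w j) (lookup w k) → Pattern R (removeAt w q)
  Pattern-removeAt⁺ w q {i} {j} {k} i≢q j≢q k≢q i<j j<k r
    with punchIn-view q i i≢q | punchIn-view q j j≢q | punchIn-view q k k≢q
  ... | i′ , refl | j′ , refl | k′ , refl =
    i′ , j′ , k′ , punchIn-cancel-< q i<j , punchIn-cancel-< q j<k ,
    subst₃ R (sym (lookup-removeAt w q i′)) (sym (lookup-removeAt w q j′)) (sym (lookup-removeAt w q k′)) r

  ¬Pattern-insertion : ∀ {m} (w : Vec ℕ (suc m)) q → ¬ Pattern R (removeAt w q) →
    (∀ {j k} → q F.< j → j F.< k → ¬ R (lookup w q) (lookup w j) (lookup w k)) →
    (∀ {i k} → i F.< q → q F.< k → ¬ R (lookup w i) (lookup w q) (lookup w k)) →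
    (∀ {i j} → i F.< j → j F.< q → ¬ R (lookup w i) (lookup w j) (lookup w q)) →
    ¬ Pattern R w
  ¬Pattern-insertion w q rest as-first as-middle as-last (i , j , k , i<j , j<k , r)
    with i FP.≟ q | j FP.≟ q | k FP.≟ q
  ... | yes refl | _        | _        = as-first i<j j<k r
  ... | no _     | yes refl | _        = as-middle i<j j<k r
  ... | no _     | no _     | yes refl = as-last i<j j<k r
  ... | no i≢q   | no j≢q   | no k≢q   = rest (Pattern-removeAt⁺ w q i≢q j≢q k≢q i<j j<k r)

Pattern-map : ∀ {R S : ℕ → ℕ → ℕ → Set} {m} (f : ℕ → ℕ) → (∀ {a b c} → R a b c → S (f a) (f b) (f c)) →
  {u : Vec ℕ m} → Pattern R u → Pattern S (V.map f u)
Pattern-map {S = S} f R⇒S {u} (i , j , k , i<j , j<k , r) =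
  i , j , k , i<j , j<k , subst₃ S (sym (VP.lookup-map i f u)) (sym (VP.lookup-map j f u)) (sym (VP.lookup-map k f u)) (R⇒S r)

Pattern-map⁻ : ∀ {R S : ℕ → ℕ → ℕ → Set} {m} (f : ℕ → ℕ) → (∀ {a b c} → S (f a) (f b) (f c) → R a b c) →
  {u : Vec ℕ m} → Pattern S (V.map f u) → Pattern R u
Pattern-map⁻ {S = S} f S⇒R {u} (i , j , k , i<j , j<k , s) =
  i , j , k , i<j , j<k , S⇒R (subst₃ S (VP.lookup-map i f u) (VP.lookup-map j f u) (VP.lookup-map k f u) s)

-- Counting by insertion
module Enumeration
  (R : ℕ → ℕ → ℕ → Set)
  (pattern? : ∀ {m} (w : Vec ℕ m) → Dec (Pattern R w))
  (encode : ∀ {n} → Vec ℕ (suc n) × Fin (3 + n) → Vec ℕ (2 + n))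
  (decode : ∀ {n} → Vec ℕ (2 + n) → Vec ℕ (suc n) × Fin (3 + n))
  (encode-avoider : ∀ {n} {u : Vec ℕ (suc n)} t → Avoider R u → Avoider R (encode (u , t)))
  (decode-avoider : ∀ {n} {w : Vec ℕ (2 + n)} → Avoider R w → Avoider R (proj₁ (decode w)))
  (decode-encode : ∀ {n} {u : Vec ℕ (suc n)} t → Avoider R u → decode (encode (u , t)) ≡ (u , t))
  (encode-decode : ∀ {n} {w : Vec ℕ (2 + n)} → Avoider R w → encode (decode w) ≡ w)
  where

  avoiders : ∀ n → List (Vec ℕ (suc n))
  avoiders zero    = (1 ∷ []) L.∷ L.[]
  avoiders (suc n) = L.map encode (cartesianProduct (avoiders n) (allFin (3 + n)))

  ∈-avoiders⁻ : ∀ n {w} → w ∈ avoiders n → Avoider R w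
  ∈-avoiders⁻ zero    (here refl) = Avoider-singleton {R = R}
  ∈-avoiders⁻ (suc n) w∈ with ∈-map⁻ encode w∈
  ... | (u , t) , ut∈ , refl = encode-avoider t (∈-avoiders⁻ n (proj₁ (∈-cartesianProduct⁻ (avoiders n) _ ut∈)))

  ∈-avoiders⁺ : ∀ n {w} → Avoider R w → w ∈ avoiders n
  ∈-avoiders⁺ zero {x ∷ []} (c , _) with IsCayley⇒Cayley c
  ... | K , cx@(cayley positive bounded _) =
    here (cong (_∷ []) (≤-antisym (≤-trans (bounded F.zero) (Cayley-≤-length {w = x ∷ []} cx)) (positive F.zero)))
  ∈-avoiders⁺ (suc n) {w} a = subst (_∈ avoiders (suc n)) (encode-decode a)
    (∈-map⁺ encode (∈-cartesianProduct⁺ (∈-avoiders⁺ n (decode-avoider a)) (∈-allFin _)))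

  avoiders-unique : ∀ n → Unique (avoiders n)
  avoiders-unique zero    = All.[] AllPairs.∷ AllPairs.[]
  avoiders-unique (suc n) =
    map-unique decode (All.tabulate decode-encode′) (Unique.cartesianProduct⁺ (avoiders-unique n) (Unique.allFin⁺ _))
    where
    decode-encode′ : ∀ {ut} → ut ∈ cartesianProduct (avoiders n) (allFin (3 + n)) → decode (encode ut) ≡ ut
    decode-encode′ {u , t} ut∈ = decode-encode t (∈-avoiders⁻ n (proj₁ (∈-cartesianProduct⁻ (avoiders n) _ ut∈)))

  length-avoiders : ∀ n → length (avoiders n) * 2 ≡ (2 + n) !
  length-avoiders zero    = refl
  length-avoiders (suc n) = begin
    length (avoiders (suc n)) * 2       ≡⟨ cong (_* 2) length-step ⟩
    (3 + n) * length (avoiders n) * 2   ≡⟨ *-assoc (3 + n) (length (avoiders n)) 2 ⟩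
    (3 + n) * (length (avoiders n) * 2) ≡⟨ cong ((3 + n) *_) (length-avoiders n) ⟩
    (3 + n) !                           ∎
    where
    open ≡-Reasoning
    length-step : length (avoiders (suc n)) ≡ (3 + n) * length (avoiders n)
    length-step = begin
      length (avoiders (suc n))
        ≡⟨ LP.length-map encode (cartesianProduct (avoiders n) (allFin (3 + n))) ⟩
      length (cartesianProduct (avoiders n) (allFin (3 + n)))
        ≡⟨ length-cartesianProductWith _,_ (avoiders n) (allFin (3 + n)) ⟩
      length (avoiders n) * length (allFin (3 + n))
        ≡⟨ cong (length (avoiders n) *_) (LP.length-tabulate id) ⟩
      length (avoiders n) * (3 + n)
        ≡⟨ *-comm (length (avoiders n)) (3 + n) ⟩
      (3 + n) * length (avoiders n) ∎

  avoider? : ∀ {m} (w : Vec ℕ m) → Dec (Avoider R w)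
  avoider? w = isCayley? w ×-dec ¬? (pattern? w)

  -- For R = Is112 / Is212 this is definitionally count112 / count212.
  count : ℕ → ℕ
  count n = length (filter avoider? (words n n))

  count≡length-avoiders : ∀ n → count (suc n) ≡ length (avoiders n)
  count≡length-avoiders n =
    unique-length (Unique.filter⁺ avoider? (words-unique (suc n) (suc n))) (avoiders-unique n)
      (λ w∈ → ∈-avoiders⁺ n (proj₂ (∈-filter⁻ avoider? {xs = words (suc n) (suc n)} w∈)))
      (λ w∈ → ∈-filter⁺ avoider? (∈-words′ (∈-avoiders⁻ n w∈)) (∈-avoiders⁻ n w∈))
    where
    ∈-words′ : ∀ {w : Vec ℕ (suc n)} → Avoider R w → w ∈ words (suc n) (suc n)
    ∈-words′ {w} (c , _) with IsCayley⇒Cayley c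
    ... | K , cw@(cayley positive bounded _) =
      ∈-words (suc n) (suc n) w positive (λ i → ≤-trans (bounded i) (Cayley-≤-length {w = w} cw))

  count-suc : ∀ n → count (suc n) ≡ (2 + n) ! / 2
  count-suc n = begin
    count (suc n)                 ≡⟨ count≡length-avoiders n ⟩
    length (avoiders n)           ≡⟨ m*n/n≡m (length (avoiders n)) 2 ⟨
    length (avoiders n) * 2 / 2   ≡⟨ cong (_/ 2) (length-avoiders n) ⟩
    (2 + n) ! / 2                 ∎
    where open ≡-Reasoning

-- Avoiding 112
Is112 : ℕ → ℕ → ℕ → Set
Is112 a b c = a ≡ b × b < c

¬112⇒ones-persist : ∀ {m} {w : Vec ℕ m} → (∀ i → 1 ≤ lookup w i) → ¬ Pattern Is112 w →
  ∀ {i j k} → i F.< j → j F.≤ k → lookup w i ≡ 1 → lookup w j ≡ 1 → lookup w k ≡ 1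
¬112⇒ones-persist {w = w} positive ¬p {i} {j} {k} i<j j≤k wi≡1 wj≡1 with j FP.≟ k
... | yes refl = wj≡1
... | no j≢k   = ≤-antisym (≮⇒≥ 1≮wk) (positive k)
  where
  1≮wk : ¬ 1 < lookup w k
  1≮wk 1<wk = ¬p (i , j , k , i<j , FP.≤∧≢⇒< j≤k j≢k , trans wi≡1 (sym wj≡1) , subst (_< lookup w k) (sym wj≡1) 1<wk)

encode112 : ∀ {n} → Vec ℕ (suc n) × Fin (3 + n) → Vec ℕ (2 + n)
encode112 (u , F.zero)  = insertAt u (fromℕ _) 1
encode112 (u , F.suc p) = insertAt (V.map suc u) p 1

decode112 : ∀ {n} → Vec ℕ (2 + n) → Vec ℕ (suc n) × Fin (3 + n)
decode112 w =
  if does (occurs? 1 (removeAt w (first 1 w)))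
  then (removeAt w (fromℕ _) , F.zero)
  else (V.map pred (removeAt w (first 1 w)) , F.suc (first 1 w))

decode112-twice : ∀ {n} {w : Vec ℕ (2 + n)} → Occurs 1 (removeAt w (first 1 w)) →
  decode112 w ≡ (removeAt w (fromℕ _) , F.zero)
decode112-twice {w = w} = if-does-yes (occurs? 1 (removeAt w (first 1 w)))

decode112-once : ∀ {n} {w : Vec ℕ (2 + n)} → ¬ Occurs 1 (removeAt w (first 1 w)) →
  decode112 w ≡ (V.map pred (removeAt w (first 1 w)) , F.suc (first 1 w))
decode112-once {w = w} = if-does-no (occurs? 1 (removeAt w (first 1 w)))

map-suc-pred : ∀ {m} (r : Vec ℕ m) → (∀ i → 1 ≤ lookup r i) → V.map suc (V.map pred r) ≡ r
map-suc-pred []      _        = refl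
map-suc-pred (x ∷ r) positive with positive F.zero
... | s≤s _ = cong (x ∷_) (map-suc-pred r (positive ∘ F.suc))

map-pred-suc : ∀ {m} (u : Vec ℕ m) → V.map pred (V.map suc u) ≡ u
map-pred-suc u = trans (sym (VP.map-∘ pred suc u)) (VP.map-id u)

module AppendOne {n} {K} (u : Vec ℕ (suc n)) (cu : Cayley K u) where
  open Cayley cu

  w : Vec ℕ (2 + n)
  w = insertAt u (fromℕ _) 1

  w-last : lookup w (fromℕ _) ≡ 1
  w-last = VP.insertAt-lookup u (fromℕ _) 1

  w-cayley : Cayley K w
  w-cayley = Cayley-insertAt cu (fromℕ _) ≤-refl (Cayley-nonempty cu)

  w-avoids : ¬ Pattern Is112 u → ¬ Pattern Is112 w
  w-avoids ¬p = ¬Pattern-insertion {R = Is112} w (fromℕ _)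
    (subst (λ v → ¬ Pattern Is112 v) (sym (VP.removeAt-insertAt u (fromℕ _) 1)) ¬p)
    (λ last<j _ _ → <⇒≱ last<j (FP.≤fromℕ _))
    (λ _ last<k _ → <⇒≱ last<k (FP.≤fromℕ _))
    (λ {_} {j} _ _ (_ , wj<1) → <⇒≱ (subst (lookup w j <_) w-last wj<1) (Cayley.positive w-cayley j))

  decode-w : decode112 w ≡ (u , F.zero)
  decode-w = trans (decode112-twice {w = w} twice) (cong (_, F.zero) (VP.removeAt-insertAt u (fromℕ _) 1))
    where
    j : Fin (suc n)
    j = proj₁ (onto 0 (Cayley-nonempty cu))
    w-j : lookup w (punchIn (fromℕ _) j) ≡ 1
    w-j = trans (VP.insertAt-punchIn u (fromℕ _) 1 j) (proj₂ (onto 0 (Cayley-nonempty cu)))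
    last≢first : fromℕ _ ≢ first 1 w
    last≢first last≡first = FP.punchInᵢ≢i (fromℕ _) j
      (FP.≤-antisym (FP.≤fromℕ _) (subst (F._≤ punchIn (fromℕ _) j) (sym last≡first) (first-≤ w w-j)))
    twice : Occurs 1 (removeAt w (first 1 w))
    twice = Occurs-removeAt w (first 1 w) last≢first w-last

module InsertOne {n} {K} (u : Vec ℕ (suc n)) (cu : Cayley K u) (p : Fin (2 + n)) where
  open Cayley cu

  w : Vec ℕ (2 + n)
  w = insertAt (V.map suc u) p 1

  w-p : lookup w p ≡ 1
  w-p = VP.insertAt-lookup (V.map suc u) p 1

  w-punchIn : ∀ j → lookup w (punchIn p j) ≡ suc (lookup u j)
  w-punchIn j = trans (VP.insertAt-punchIn (V.map suc u) p 1 j) (VP.lookup-map j suc u)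

  w-others : ∀ {i} → i ≢ p → 2 ≤ lookup w i
  w-others {i} i≢p with punchIn-view p i i≢p
  ... | j , refl = subst (2 ≤_) (sym (w-punchIn j)) (s≤s (positive j))

  w-cayley : Cayley (suc K) w
  w-cayley = cayley (∀-insertAt (1 ≤_) (V.map suc u) p ≤-refl suc-u-positive)
                    (∀-insertAt (_≤ suc K) (V.map suc u) p (s≤s z≤n) suc-u-bounded)
                    onto′
    where
    suc-u-positive : ∀ j → 1 ≤ lookup (V.map suc u) j
    suc-u-positive j = subst (1 ≤_) (sym (VP.lookup-map j suc u)) (s≤s z≤n)
    suc-u-bounded : ∀ j → lookup (V.map suc u) j ≤ suc K
    suc-u-bounded j = subst (_≤ suc K) (sym (VP.lookup-map j suc u)) (s≤s (bounded j))
    onto′ : ∀ v → v < suc K → Occurs (suc v) w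
    onto′ zero    _         = p , w-p
    onto′ (suc v) (s≤s v<K) = Occurs-insertAt (V.map suc u) p 1 (Occurs-map suc u (onto v v<K))

  w-avoids : ¬ Pattern Is112 u → ¬ Pattern Is112 w
  w-avoids ¬p = ¬Pattern-insertion {R = Is112} w p
    (subst (λ v → ¬ Pattern Is112 v) (sym (VP.removeAt-insertAt (V.map suc u) p 1))
           (¬p ∘ Pattern-map⁻ {R = Is112} {S = Is112} suc (λ (e , lt) → suc-injective e , ≤-pred lt) {u = u}))
    (λ p<j _ (1≡wj , _) → <⇒≱ (w-others (FP.<⇒≢ p<j ∘ sym)) (≤-reflexive (trans (sym 1≡wj) w-p)))
    (λ i<p _ (wi≡1 , _) → <⇒≱ (w-others (FP.<⇒≢ i<p)) (≤-reflexive (trans wi≡1 w-p)))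
    (λ {_} {j} _ _ (_ , wj<1) → <⇒≱ (subst (lookup w j <_) w-p wj<1) (Cayley.positive w-cayley j))

  first-w : first 1 w ≡ p
  first-w = first-unique w w-p p-least
    where
    p-least : ∀ {i} → lookup w i ≡ 1 → p F.≤ i
    p-least {i} wi≡1 with i FP.≟ p
    ... | yes refl = ≤-refl
    ... | no i≢p   = ⊥-elim (<⇒≱ (w-others i≢p) (≤-reflexive wi≡1))

  decode-w : decode112 w ≡ (u , F.suc p)
  decode-w = begin
    decode112 w
      ≡⟨ decode112-once {w = w} (subst (λ q → ¬ Occurs 1 (removeAt w q)) (sym first-w) once) ⟩
    (V.map pred (removeAt w (first 1 w)) , F.suc (first 1 w))
      ≡⟨ cong (λ q → V.map pred (removeAt w q) , F.suc q) first-w ⟩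
    (V.map pred (removeAt w p) , F.suc p)
      ≡⟨ cong (λ v → V.map pred v , F.suc p) (VP.removeAt-insertAt (V.map suc u) p 1) ⟩
    (V.map pred (V.map suc u) , F.suc p)
      ≡⟨ cong (_, F.suc p) (map-pred-suc u) ⟩
    (u , F.suc p) ∎
    where
    open ≡-Reasoning
    once : ¬ Occurs 1 (removeAt w p)
    once (j , rj≡1) = <⇒≱ (w-others (FP.punchInᵢ≢i p j)) (≤-reflexive (trans (sym (lookup-removeAt w p j)) rj≡1))

module Decode112 {n} {K} (w : Vec ℕ (2 + n)) (cw : Cayley K w) (¬p : ¬ Pattern Is112 w) where
  open Cayley cw

  f : Fin (2 + n)
  f = first 1 w

  r : Vec ℕ (suc n)
  r = removeAt w f

  w-f : lookup w f ≡ 1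
  w-f = lookup-first w (onto 0 (Cayley-nonempty cw))

  module Twice (twice : Occurs 1 r) where
    j : Fin (2 + n)
    j = punchIn f (proj₁ twice)

    w-j : lookup w j ≡ 1
    w-j = trans (sym (lookup-removeAt w f (proj₁ twice))) (proj₂ twice)

    f<j : f F.< j
    f<j = FP.≤∧≢⇒< (first-≤ w w-j) (FP.punchInᵢ≢i f (proj₁ twice) ∘ sym)

    w-last : lookup w (fromℕ _) ≡ 1
    w-last = ¬112⇒ones-persist {w = w} positive ¬p f<j (FP.≤fromℕ j) w-f w-j

    u : Vec ℕ (suc n)
    u = removeAt w (fromℕ _)

    u-cayley : Cayley K u
    u-cayley = cayley (∀-removeAt (1 ≤_) w (fromℕ _) positive) (∀-removeAt (_≤ K) w (fromℕ _) bounded) onto′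
      where
      f≢last : f ≢ fromℕ _
      f≢last f≡last = <⇒≱ f<j (subst (j F.≤_) (sym f≡last) (FP.≤fromℕ j))
      onto′ : ∀ v → v < K → Occurs (suc v) u
      onto′ v v<K with onto v v<K
      ... | i , wi≡ with i FP.≟ fromℕ _
      ...   | no i≢last = Occurs-removeAt w (fromℕ _) i≢last wi≡
      ...   | yes refl  = Occurs-removeAt w (fromℕ _) f≢last (trans w-f (trans (sym w-last) wi≡))

    u-avoids : ¬ Pattern Is112 u
    u-avoids = ¬p ∘ Pattern-removeAt⁻ {R = Is112} w (fromℕ _)

    encode-u : encode112 (u , F.zero) ≡ w
    encode-u = trans (cong (insertAt u (fromℕ _)) (sym w-last)) (VP.insertAt-removeAt w (fromℕ _))

  module Once (once : ¬ Occurs 1 r) where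
    r-positive : ∀ j → 1 ≤ lookup r j
    r-positive = ∀-removeAt (1 ≤_) w f positive

    r≥2 : ∀ j → 2 ≤ lookup r j
    r≥2 j = ≤∧≢⇒< (r-positive j) (λ 1≡rj → once (j , sym 1≡rj))

    u : Vec ℕ (suc n)
    u = V.map pred r

    suc-u : V.map suc u ≡ r
    suc-u = map-suc-pred r r-positive

    u-cayley : Cayley (pred K) u
    u-cayley = cayley (λ j → subst (1 ≤_) (sym (VP.lookup-map j pred r)) (pred-mono-≤ (r≥2 j)))
                      (λ j → subst (_≤ pred K) (sym (VP.lookup-map j pred r)) (pred-mono-≤ (∀-removeAt (_≤ K) w f bounded j)))
                      onto′
      where
      onto′ : ∀ v → v < pred K → Occurs (suc v) u
      onto′ v v<K-1 with onto (suc v) (pred-cancel-< v<K-1)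
      ... | i , wi≡ with i FP.≟ f
      ...   | yes refl = ⊥-elim (0≢1+n (suc-injective (trans (sym w-f) wi≡)))
      ...   | no i≢f   = Occurs-map pred r (Occurs-removeAt w f i≢f wi≡)

    u-avoids : ¬ Pattern Is112 u
    u-avoids = ¬p ∘ Pattern-removeAt⁻ {R = Is112} w f ∘ subst (Pattern Is112) suc-u
             ∘ Pattern-map {R = Is112} {S = Is112} suc (λ (e , lt) → cong suc e , s≤s lt) {u = u}

    encode-u : encode112 (u , F.suc f) ≡ w
    encode-u = begin
      insertAt (V.map suc u) f 1        ≡⟨ cong (λ v → insertAt v f 1) suc-u ⟩
      insertAt r f 1                    ≡⟨ cong (insertAt r f) w-f ⟨
      insertAt r f (lookup w f)         ≡⟨ VP.insertAt-removeAt w f ⟩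
      w                                 ∎
      where open ≡-Reasoning

encode112-avoider : ∀ {n} {u : Vec ℕ (suc n)} t → Avoider Is112 u → Avoider Is112 (encode112 (u , t))
encode112-avoider {u = u} F.zero (c , ¬p) with IsCayley⇒Cayley c
... | _ , cu = Cayley⇒IsCayley (AppendOne.w-cayley u cu) , AppendOne.w-avoids u cu ¬p
encode112-avoider {u = u} (F.suc p) (c , ¬p) with IsCayley⇒Cayley c
... | _ , cu = Cayley⇒IsCayley (InsertOne.w-cayley u cu p) , InsertOne.w-avoids u cu p ¬p

decode112-encode112 : ∀ {n} {u : Vec ℕ (suc n)} t → Avoider Is112 u → decode112 (encode112 (u , t)) ≡ (u , t)
decode112-encode112 {u = u} F.zero (c , _) with IsCayley⇒Cayley c
... | _ , cu = AppendOne.decode-w u cu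
decode112-encode112 {u = u} (F.suc p) (c , _) with IsCayley⇒Cayley c
... | _ , cu = InsertOne.decode-w u cu p

decode112-avoider : ∀ {n} {w : Vec ℕ (2 + n)} → Avoider Is112 w → Avoider Is112 (proj₁ (decode112 w))
decode112-avoider {w = w} (c , ¬p) with IsCayley⇒Cayley c
... | _ , cw with occurs? 1 (Decode112.r w cw ¬p)
...   | yes twice rewrite decode112-twice {w = w} twice =
  Cayley⇒IsCayley (Decode112.Twice.u-cayley w cw ¬p twice) , Decode112.Twice.u-avoids w cw ¬p twice
...   | no once rewrite decode112-once {w = w} once =
  Cayley⇒IsCayley (Decode112.Once.u-cayley w cw ¬p once) , Decode112.Once.u-avoids w cw ¬p once

encode112-decode112 : ∀ {n} {w : Vec ℕ (2 + n)} → Avoider Is112 w → encode112 (decode112 w) ≡ w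
encode112-decode112 {w = w} (c , ¬p) with IsCayley⇒Cayley c
... | _ , cw with occurs? 1 (Decode112.r w cw ¬p)
...   | yes twice rewrite decode112-twice {w = w} twice = Decode112.Twice.encode-u w cw ¬p twice
...   | no once rewrite decode112-once {w = w} once = Decode112.Once.encode-u w cw ¬p once

module Count112 = Enumeration Is112 contains112? encode112 decode112
  encode112-avoider (λ {n} {w} → decode112-avoider {n} {w})
  decode112-encode112 (λ {n} {w} → encode112-decode112 {n} {w})

-- Avoiding 212
Is212 : ℕ → ℕ → ℕ → Set
Is212 a b c = a ≡ c × b < c

¬212⇒maxima-contiguous : ∀ {m} {w : Vec ℕ m} {M} → (∀ i → lookup w i ≤ M) → ¬ Pattern Is212 w →
  ∀ {i j k} → i F.< j → j F.≤ k → lookup w i ≡ M → lookup w k ≡ M → lookup w j ≡ M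
¬212⇒maxima-contiguous {w = w} {M} bounded ¬p {i} {j} {k} i<j j≤k wi≡M wk≡M with j FP.≟ k
... | yes refl = wk≡M
... | no j≢k   = ≤-antisym (bounded j) (≮⇒≥ wj≮M)
  where
  wj≮M : ¬ lookup w j < M
  wj≮M wj<M = ¬p (i , j , k , i<j , FP.≤∧≢⇒< j≤k j≢k , trans wi≡M (sym wk≡M) , subst (lookup w j <_) (sym wk≡M) wj<M)

encode212 : ∀ {n} → Vec ℕ (suc n) × Fin (3 + n) → Vec ℕ (2 + n)
encode212 (u , F.zero)  = insertAt u (F.inject₁ (first (maximum u) u)) (maximum u)
encode212 (u , F.suc p) = insertAt u p (suc (maximum u))

decode212 : ∀ {n} → Vec ℕ (2 + n) → Vec ℕ (suc n) × Fin (3 + n)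
decode212 w =
  removeAt w (first (maximum w) w) ,
  (if does (occurs? (maximum w) (removeAt w (first (maximum w) w)))
   then F.zero
   else F.suc (first (maximum w) w))

decode212-twice : ∀ {n} {w : Vec ℕ (2 + n)} → Occurs (maximum w) (removeAt w (first (maximum w) w)) →
  decode212 w ≡ (removeAt w (first (maximum w) w) , F.zero)
decode212-twice {w = w} h = cong (removeAt w (first (maximum w) w) ,_) (if-does-yes (occurs? (maximum w) (removeAt w (first (maximum w) w))) h)

decode212-once : ∀ {n} {w : Vec ℕ (2 + n)} → ¬ Occurs (maximum w) (removeAt w (first (maximum w) w)) →
  decode212 w ≡ (removeAt w (first (maximum w) w) , F.suc (first (maximum w) w))
decode212-once {w = w} ¬h = cong (removeAt w (first (maximum w) w) ,_) (if-does-no (occurs? (maximum w) (removeAt w (first (maximum w) w))) ¬h)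

module InsertMax {n} (u : Vec ℕ (suc n)) (cu : Cayley (maximum u) u) (p : Fin (2 + n)) where
  open Cayley cu

  M : ℕ
  M = maximum u

  w : Vec ℕ (2 + n)
  w = insertAt u p (suc M)

  w-p : lookup w p ≡ suc M
  w-p = VP.insertAt-lookup u p (suc M)

  w-others : ∀ {i} → i ≢ p → lookup w i ≤ M
  w-others {i} i≢p with punchIn-view p i i≢p
  ... | j , refl = subst (_≤ M) (sym (VP.insertAt-punchIn u p (suc M) j)) (bounded j)

  w-cayley : Cayley (suc M) w
  w-cayley = cayley (∀-insertAt (1 ≤_) u p (s≤s z≤n) positive) (∀-insertAt (_≤ suc M) u p ≤-refl (m≤n⇒m≤1+n ∘ bounded)) onto′
    where
    onto′ : ∀ v → v < suc M → Occurs (suc v) w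
    onto′ v (s≤s v≤M) with m≤n⇒m<n∨m≡n v≤M
    ... | inj₁ v<M = Occurs-insertAt u p (suc M) (onto v v<M)
    ... | inj₂ refl = p , w-p

  1+M≰others : ∀ {i} → i ≢ p → lookup w i ≢ suc M
  1+M≰others i≢p wi≡1+M = <⇒≱ (n<1+n M) (subst (_≤ M) wi≡1+M (w-others i≢p))

  w-avoids : ¬ Pattern Is212 u → ¬ Pattern Is212 w
  w-avoids ¬p = ¬Pattern-insertion {R = Is212} w p
    (subst (λ v → ¬ Pattern Is212 v) (sym (VP.removeAt-insertAt u p (suc M))) ¬p)
    (λ {j} {k} p<j j<k (wp≡wk , _) → 1+M≰others (FP.<⇒≢ (FP.<-trans p<j j<k) ∘ sym) (trans (sym wp≡wk) w-p))
    (λ {i} {k} _ _ (_ , wp<wk) → <⇒≱ (subst (_< lookup w k) w-p wp<wk) (Cayley.bounded w-cayley k))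
    (λ {i} i<j j<p (wi≡wp , _) → 1+M≰others (FP.<⇒≢ (FP.<-trans i<j j<p)) (trans wi≡wp w-p))

  maximum-w : maximum w ≡ suc M
  maximum-w = Cayley-maximum w-cayley

  first-w : first (maximum w) w ≡ p
  first-w = trans (cong (λ v → first v w) maximum-w) (first-unique w w-p p-least)
    where
    p-least : ∀ {i} → lookup w i ≡ suc M → p F.≤ i
    p-least {i} wi≡1+M with i FP.≟ p
    ... | yes refl = ≤-refl
    ... | no i≢p   = ⊥-elim (1+M≰others i≢p wi≡1+M)

  decode-w : decode212 w ≡ (u , F.suc p)
  decode-w = begin
    decode212 w
      ≡⟨ decode212-once {w = w} once ⟩
    (removeAt w (first (maximum w) w) , F.suc (first (maximum w) w))
      ≡⟨ cong (λ q → removeAt w q , F.suc q) first-w ⟩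
    (removeAt w p , F.suc p)
      ≡⟨ cong (_, F.suc p) (VP.removeAt-insertAt u p (suc M)) ⟩
    (u , F.suc p) ∎
    where
    open ≡-Reasoning
    once : ¬ Occurs (maximum w) (removeAt w (first (maximum w) w))
    once (j , rj≡max) rewrite first-w | maximum-w =
      1+M≰others (FP.punchInᵢ≢i p j) (trans (sym (lookup-removeAt w p j)) rj≡max)

module DuplicateMax {n} (u : Vec ℕ (suc n)) (cu : Cayley (maximum u) u) where
  open Cayley cu

  M : ℕ
  M = maximum u

  q : Fin (suc n)
  q = first M u

  u-q : lookup u q ≡ M
  u-q = lookup-first u (Cayley-top cu)

  slot : Fin (2 + n)
  slot = F.inject₁ q

  w : Vec ℕ (2 + n)
  w = insertAt u slot M

  w-slot : lookup w slot ≡ M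
  w-slot = VP.insertAt-lookup u slot M

  w-suc-q : lookup w (F.suc q) ≡ M
  w-suc-q = begin
    lookup w (F.suc q)          ≡⟨ cong (lookup w) (punchIn-inject₁-self q) ⟨
    lookup w (punchIn slot q)   ≡⟨ VP.insertAt-punchIn u slot M q ⟩
    lookup u q                  ≡⟨ u-q ⟩
    M                           ∎
    where open ≡-Reasoning

  w-cayley : Cayley M w
  w-cayley = Cayley-insertAt cu slot (Cayley-nonempty cu) ≤-refl

  slot-least : ∀ {i} → lookup w i ≡ M → slot F.≤ i
  slot-least {i} wi≡M with i FP.≟ slot
  ... | yes refl = ≤-refl
  ... | no i≢slot with punchIn-view slot i i≢slot
  ...   | i′ , refl = inject₁≤punchIn (first-≤ u (trans (sym (VP.insertAt-punchIn u slot M i′)) wi≡M))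

  w-avoids : ¬ Pattern Is212 u → ¬ Pattern Is212 w
  w-avoids ¬p = ¬Pattern-insertion {R = Is212} w slot rest as-first as-middle as-last
    where
    rest : ¬ Pattern Is212 (removeAt w slot)
    rest = subst (λ v → ¬ Pattern Is212 v) (sym (VP.removeAt-insertAt u slot M)) ¬p
    -- An occurrence starting at the inserted M also starts at the original M right after it.
    as-first : ∀ {j k} → slot F.< j → j F.< k → ¬ Is212 (lookup w slot) (lookup w j) (lookup w k)
    as-first {j} {k} slot<j j<k (wslot≡wk , wj<wk) =
      rest (Pattern-removeAt⁺ {R = Is212} w slot suc-q≢slot (FP.<⇒≢ slot<j ∘ sym) (FP.<⇒≢ (FP.<-trans slot<j j<k) ∘ sym)
              suc-q<j j<k (trans w-suc-q (sym wk≡M) , wj<wk))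
      where
      wk≡M : lookup w k ≡ M
      wk≡M = trans (sym wslot≡wk) w-slot
      suc-q≢slot : F.suc q ≢ slot
      suc-q≢slot = subst (_≢ slot) (punchIn-inject₁-self q) (FP.punchInᵢ≢i slot q)
      suc-q<j : F.suc q F.< j
      suc-q<j = FP.≤∧≢⇒< (inject₁<⇒suc≤ slot<j)
        (λ suc-q≡j → <-irrefl refl (subst₂ _<_ (trans (cong (lookup w) (sym suc-q≡j)) w-suc-q) wk≡M wj<wk))
    as-middle : ∀ {i k} → i F.< slot → slot F.< k → ¬ Is212 (lookup w i) (lookup w slot) (lookup w k)
    as-middle {k = k} _ _ (_ , wslot<wk) = <⇒≱ (subst (_< lookup w k) w-slot wslot<wk) (Cayley.bounded w-cayley k)
    as-last : ∀ {i j} → i F.< j → j F.< slot → ¬ Is212 (lookup w i) (lookup w j) (lookup w slot)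
    as-last i<j j<slot (wi≡wslot , _) = <⇒≱ (FP.<-trans i<j j<slot) (slot-least (trans wi≡wslot w-slot))

  maximum-w : maximum w ≡ M
  maximum-w = Cayley-maximum w-cayley

  removeAt-first-w : removeAt w (first (maximum w) w) ≡ u
  removeAt-first-w = begin
    removeAt w (first (maximum w) w)  ≡⟨ cong (λ v → removeAt w (first v w)) maximum-w ⟩
    removeAt w (first M w)            ≡⟨ cong (removeAt w) (first-unique w w-slot slot-least) ⟩
    removeAt w slot                   ≡⟨ VP.removeAt-insertAt u slot M ⟩
    u                                 ∎
    where open ≡-Reasoning

  decode-w : decode212 w ≡ (u , F.zero)
  decode-w = trans (decode212-twice {w = w} twice) (cong (_, F.zero) removeAt-first-w)
    where
    twice : Occurs (maximum w) (removeAt w (first (maximum w) w))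
    twice rewrite removeAt-first-w | maximum-w = Cayley-top cu

module Decode212 {n} (w : Vec ℕ (2 + n)) (cw : Cayley (maximum w) w) (¬p : ¬ Pattern Is212 w) where
  open Cayley cw

  M : ℕ
  M = maximum w

  f : Fin (2 + n)
  f = first M w

  r : Vec ℕ (suc n)
  r = removeAt w f

  w-f : lookup w f ≡ M
  w-f = lookup-first w (Cayley-top cw)

  r-bounded : ∀ j → lookup r j ≤ M
  r-bounded = ∀-removeAt (_≤ M) w f bounded

  r-avoids : ¬ Pattern Is212 r
  r-avoids = ¬p ∘ Pattern-removeAt⁻ {R = Is212} w f

  module Twice (twice : Occurs M r) where
    j : Fin (2 + n)
    j = punchIn f (proj₁ twice)

    w-j : lookup w j ≡ M
    w-j = trans (sym (lookup-removeAt w f (proj₁ twice))) (proj₂ twice)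

    f<j : f F.< j
    f<j = FP.≤∧≢⇒< (first-≤ w w-j) (FP.punchInᵢ≢i f (proj₁ twice) ∘ sym)

    f≢last : suc n ≢ toℕ f
    f≢last 1+n≡f = <⇒≱ f<j (subst (toℕ j ≤_) 1+n≡f (FP.toℕ≤pred[n] j))

    y : Fin (suc n)
    y = F.lower₁ f f≢last

    inject₁-y : F.inject₁ y ≡ f
    inject₁-y = FP.inject₁-lower₁ f f≢last

    r-y : lookup r y ≡ M
    r-y = begin
      lookup r y                           ≡⟨ lookup-removeAt w f y ⟩
      lookup w (punchIn f y)               ≡⟨ cong (λ x → lookup w (punchIn x y)) inject₁-y ⟨
      lookup w (punchIn (F.inject₁ y) y)   ≡⟨ cong (lookup w) (punchIn-inject₁-self y) ⟩
      lookup w (F.suc y)                   ≡⟨ ¬212⇒maxima-contiguous {w = w} bounded ¬p (FP.≤̄⇒inject₁< FP.≤-refl)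
                                                (inject₁<⇒suc≤ (subst (F._< j) (sym inject₁-y) f<j))
                                                (subst (λ x → lookup w x ≡ M) (sym inject₁-y) w-f) w-j ⟩
      M                                    ∎
      where open ≡-Reasoning

    first-r : F.inject₁ (first M r) ≡ f
    first-r = trans (cong F.inject₁ (first-unique r r-y y-least)) inject₁-y
      where
      y-least : ∀ {i} → lookup r i ≡ M → y F.≤ i
      y-least {i} ri≡M = inject₁<punchIn⇒≤ (subst (λ x → x F.< punchIn x i) (sym inject₁-y) f<punchIn)
        where
        f<punchIn : f F.< punchIn f i
        f<punchIn = FP.≤∧≢⇒< (first-≤ w (trans (sym (lookup-removeAt w f i)) ri≡M)) (FP.punchInᵢ≢i f i ∘ sym)

    r-cayley : Cayley M r
    r-cayley = cayley (∀-removeAt (1 ≤_) w f positive) r-bounded onto′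
      where
      onto′ : ∀ v → v < M → Occurs (suc v) r
      onto′ v v<M with onto v v<M
      ... | i , wi≡ with i FP.≟ f
      ...   | no i≢f   = Occurs-removeAt w f i≢f wi≡
      ...   | yes refl = proj₁ twice , trans (proj₂ twice) (trans (sym w-f) wi≡)

    encode-r : encode212 (r , F.zero) ≡ w
    encode-r = begin
      insertAt r (F.inject₁ (first (maximum r) r)) (maximum r)
        ≡⟨ cong (λ v → insertAt r (F.inject₁ (first v r)) v) (maximum-attained r r-bounded twice) ⟩
      insertAt r (F.inject₁ (first M r)) M  ≡⟨ cong (λ x → insertAt r x M) first-r ⟩
      insertAt r f M                        ≡⟨ cong (insertAt r f) w-f ⟨
      insertAt r f (lookup w f)             ≡⟨ VP.insertAt-removeAt w f ⟩
      w                                     ∎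
      where open ≡-Reasoning

  module Once (once : ¬ Occurs M r) where
    r-cayley : Cayley (pred M) r
    r-cayley = cayley (∀-removeAt (1 ≤_) w f positive) (λ j → <⇒≤pred (≤∧≢⇒< (r-bounded j) (λ rj≡M → once (j , rj≡M)))) onto′
      where
      onto′ : ∀ v → v < pred M → Occurs (suc v) r
      onto′ v v<M-1 with onto v (<-≤-trans v<M-1 pred[n]≤n)
      ... | i , wi≡ with i FP.≟ f
      ...   | no i≢f   = Occurs-removeAt w f i≢f wi≡
      ...   | yes refl = ⊥-elim (<-irrefl refl (subst (λ x → v < pred x) (trans (sym w-f) wi≡) v<M-1))

    encode-r : encode212 (r , F.suc f) ≡ w
    encode-r = begin
      insertAt r f (suc (maximum r))   ≡⟨ cong (λ v → insertAt r f (suc v)) (Cayley-maximum r-cayley) ⟩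
      insertAt r f (suc (pred M))      ≡⟨ cong (insertAt r f) (suc-pred M {{>-nonZero (Cayley-nonempty cw)}}) ⟩
      insertAt r f M                   ≡⟨ cong (insertAt r f) w-f ⟨
      insertAt r f (lookup w f)        ≡⟨ VP.insertAt-removeAt w f ⟩
      w                                ∎
      where open ≡-Reasoning

encode212-avoider : ∀ {n} {u : Vec ℕ (suc n)} t → Avoider Is212 u → Avoider Is212 (encode212 (u , t))
encode212-avoider {u = u} F.zero (c , ¬p) with Cayley-at-maximum (proj₂ (IsCayley⇒Cayley c))
... | cu = Cayley⇒IsCayley (DuplicateMax.w-cayley u cu) , DuplicateMax.w-avoids u cu ¬p
encode212-avoider {u = u} (F.suc p) (c , ¬p) with Cayley-at-maximum (proj₂ (IsCayley⇒Cayley c))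
... | cu = Cayley⇒IsCayley (InsertMax.w-cayley u cu p) , InsertMax.w-avoids u cu p ¬p

decode212-encode212 : ∀ {n} {u : Vec ℕ (suc n)} t → Avoider Is212 u → decode212 (encode212 (u , t)) ≡ (u , t)
decode212-encode212 {u = u} F.zero    (c , _) = DuplicateMax.decode-w u (Cayley-at-maximum (proj₂ (IsCayley⇒Cayley c)))
decode212-encode212 {u = u} (F.suc p) (c , _) = InsertMax.decode-w u (Cayley-at-maximum (proj₂ (IsCayley⇒Cayley c))) p

decode212-avoider : ∀ {n} {w : Vec ℕ (2 + n)} → Avoider Is212 w → Avoider Is212 (proj₁ (decode212 w))
decode212-avoider {w = w} (c , ¬p) with Cayley-at-maximum (proj₂ (IsCayley⇒Cayley c))
... | cw with occurs? (maximum w) (Decode212.r w cw ¬p)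
...   | yes twice = Cayley⇒IsCayley (Decode212.Twice.r-cayley w cw ¬p twice) , Decode212.r-avoids w cw ¬p
...   | no once   = Cayley⇒IsCayley (Decode212.Once.r-cayley w cw ¬p once) , Decode212.r-avoids w cw ¬p

encode212-decode212 : ∀ {n} {w : Vec ℕ (2 + n)} → Avoider Is212 w → encode212 (decode212 w) ≡ w
encode212-decode212 {w = w} (c , ¬p) with Cayley-at-maximum (proj₂ (IsCayley⇒Cayley c))
... | cw with occurs? (maximum w) (Decode212.r w cw ¬p)
...   | yes twice rewrite decode212-twice {w = w} twice = Decode212.Twice.encode-r w cw ¬p twice
...   | no once   rewrite decode212-once {w = w} once   = Decode212.Once.encode-r w cw ¬p once

module Count212 = Enumeration Is212 contains212? encode212 decode212
  encode212-avoider (λ {n} {w} → decode212-avoider {n} {w})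
  decode212-encode212 (λ {n} {w} → encode212-decode212 {n} {w})

corollary6p8 : (count112 0 ≡ 1 × count212 0 ≡ 1)
    × (∀ n → 1 ≤ n → count112 n ≡ suc n ! / 2 × count212 n ≡ suc n ! / 2)
corollary6p8 = (refl , refl) , λ { zero () ; (suc n) _ → Count112.count-suc n , Count212.count-suc n }
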